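{- Let $\mathcal{A}=(\mathbb{N},S^{\mathcal{A}})$ be a punctual copy of $(\mathbb{N},S)$ and let $\widetilde{\mathcal{A}}$ be the copy obtained from $\mathcal{A}$ by the binary-expansion construction. Then the images $S^{\widetilde{\mathcal{A}}}$ and $+^{\widetilde{\mathcal{A}}}$ of the successor and of addition in $\widetilde{\mathcal{A}}$ are primitive recursive.
   Context: $S$ is the successor on $\mathbb{N}$. A punctual copy of $(\mathbb{N},S)$ is $\mathcal{A}=(\mathbb{N},S^{\mathcal{A}})$ isomorphic to $(\mathbb{N},S)$ with $S^{\mathcal{A}}$ primitive recursive; let $c:(\mathbb{N},S)\to\mathcal{A}$ be the isomorphism. Define $\widetilde{c}:\mathbb{N}\to\mathbb{N}$ by $\widetilde{c}(0)=0$ and $\widetilde{c}(2^{i_k}+2^{i_{k-1}}+\dots+2^{i_0}) = 2^{c(i_k)}+2^{c(i_{k-1})}+\dots+2^{c(i_0)}$ for distinct $i_k>\dots>i_0$ (a bijection of $\mathbb{N}$). $\widetilde{\mathcal{A}}=(\mathbb{N},S^{\widetilde{\mathcal{A}}})$ is the copy of $(\mathbb{N},S)$ with isomorphism $\widetilde{c}$, i.e. $S^{\widetilde{\mathcal{A}}}(\widetilde{c}(n))=\widetilde{c}(n+1)$. For $f:\mathbb{N}^k\to\mathbb{N}$, its image in a copy with isomorphism $d$ is $(x_1,\dots,x_k)\mapsto d(f(d^{ -1}(x_1),\dots,d^{ -1}(x_k)))$; thus $x+^{\widetilde{\mathcal{A}}}y=\widetilde{c}(\widetilde{c}^{ -1}(x)+\widetilde{c}^{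 -1}(y))$. -}

module Defs where

open import Data.Nat using (ℕ; zero; suc; _+_; _*_; _^_; _%_; ⌊_/2⌋)
open import Data.Fin using (Fin)
open import Data.Vec using (Vec; []; _∷_; lookup)
open import Data.Product using (Σ; ∃; _×_; _,_)
open import Function.Definitions using (Bijective)
open import Relation.Binary.PropositionalEquality using (_≡_)

data PR : ℕ → Set where
  zer  : PR 0
  succ : PR 1
  proj : ∀ {k} → Fin k → PR k
  comp : ∀ {m k} → PR m → Vec (PR k) m → PR k
  prec : ∀ {k} → PR k → PR (suc (suc k)) → PR (suc k)

mutual
  eval : ∀ {k} → PR k → Vec ℕ k → ℕ
  eval zer        xs       = 0
  eval succ       (x ∷ []) = suc x
  eval (proj i)   xs       = lookup xs i
  eval (comp f gs) xs      = eval f (evalAll gs xs)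
  eval (prec f g) (zero ∷ xs)  = eval f xs
  eval (prec f g) (suc n ∷ xs) = eval g (n ∷ eval (prec f g) (n ∷ xs) ∷ xs)

  evalAll : ∀ {m k} → Vec (PR k) m → Vec ℕ k → Vec ℕ m
  evalAll []       xs = []
  evalAll (g ∷ gs) xs = eval g xs ∷ evalAll gs xs

PrimRec₁ : (ℕ → ℕ) → Set
PrimRec₁ f = Σ (PR 1) λ p → ∀ x → eval p (x ∷ []) ≡ f x

PrimRec₂ : (ℕ → ℕ → ℕ) → Set
PrimRec₂ f = Σ (PR 2) λ p → ∀ x y → eval p (x ∷ y ∷ []) ≡ f x y

record PunctualCopy : Set where
  field
    SA      : ℕ → ℕ
    SA-pr   : PrimRec₁ SA
    c       : ℕ → ℕ
    c-bij   : Bijective _≡_ _≡_ c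
    c-hom   : ∀ n → c (suc n) ≡ SA (c n)

bit : ℕ → ℕ → ℕ
bit n zero    = n % 2
bit n (suc i) = bit ⌊ n /2⌋ i

sumBelow : ℕ → (ℕ → ℕ) → ℕ
sumBelow zero    f = 0
sumBelow (suc k) f = sumBelow k f + f k

-- c̃(Σ 2^{i_j}) = Σ 2^{c(i_j)}; bits of n at positions ≥ n vanish (n < 2^n).
ctilde : (ℕ → ℕ) → ℕ → ℕ
ctilde c n = sumBelow n (λ i → bit n i * 2 ^ c i)

-- Digit i of n sits at position c i of c̃ n, so c̃ just relocates binary digits along c.
-- Adding 2^i to n is therefore a carry loop on c̃ n that starts at position c i: a set digit is
-- cleared and the carry moves on to S^A (c i) = c (i + 1), a clear digit is set and the loop
-- stops. It only needs S^A, and c̃ n + 1 steps suffice because every carry lowers the value,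
-- so it is primitive recursive; S^Ã is the case i = 0. For x +^Ã y, scan the positions p < y
-- and add 2^(c⁻¹ p) to x, by the same loop at position p, whenever digit p of y is set: the
-- total added is the digit relocation of y along c⁻¹, which is the inverse of c̃.

module Submission where

open import Defs
open import Data.Nat using (ℕ; zero; suc; _+_; _*_; _∸_; _^_; _%_; ⌊_/2⌋; pred; _≤_; _<_; _≤?_; z≤n; s≤s)
open import Data.Nat.Properties
open import Data.Nat.DivMod using ([m+kn]%n≡m%n)
open import Data.Nat.GeneralisedArithmetic using (fold; iterate; fold-+; iterate-is-fold; id-is-fold)
open import Data.Fin using (Fin; #_)
open import Data.Vec using (Vec; []; _∷_; lookup)
open import Data.Vec.N-ary using (N-ary; _$ⁿ_)
open import Data.Product using (Σ; ∃; _,_; proj₁; proj₂; _×_)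
open import Data.Sum using (_⊎_; inj₁; inj₂)
open import Function using (_∘_)
open import Function.Definitions using (Injective; Bijective)
open import Relation.Binary.PropositionalEquality
open import Relation.Nullary using (yes; no; contradiction)

-- Primitive recursive functions

IsPR : ∀ k → (Vec ℕ k → ℕ) → Set
IsPR k f = Σ (PR k) λ p → ∀ xs → eval p xs ≡ f xs

IsPR* : ∀ k m → (Vec ℕ k → Vec ℕ m) → Set
IsPR* k m f = Σ (Vec (PR k) m) λ ps → ∀ xs → evalAll ps xs ≡ f xs

PrimRec : ∀ k → N-ary k ℕ ℕ → Set
PrimRec k f = IsPR k (f $ⁿ_)

PrimRec₁⇒PrimRec : ∀ {f} → PrimRec₁ f → PrimRec 1 f
PrimRec₁⇒PrimRec (p , p≗f) = p , λ { (x ∷ []) → p≗f x }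

PrimRec⇒PrimRec₁ : ∀ {f} → PrimRec 1 f → PrimRec₁ f
PrimRec⇒PrimRec₁ (p , p≗f) = p , λ x → p≗f (x ∷ [])

PrimRec⇒PrimRec₂ : ∀ {f} → PrimRec 2 f → PrimRec₂ f
PrimRec⇒PrimRec₂ (p , p≗f) = p , λ x y → p≗f (x ∷ y ∷ [])

IsPR-cong : ∀ {k f g} → IsPR k f → (∀ xs → f xs ≡ g xs) → IsPR k g
IsPR-cong (p , p≗f) f≗g = p , λ xs → trans (p≗f xs) (f≗g xs)

π : ∀ {k} (i : Fin k) → IsPR k (λ xs → lookup xs i)
π i = proj i , λ _ → refl

[]ᴾ : ∀ {k} → IsPR* k 0 (λ _ → [])
[]ᴾ = [] , λ _ → refl

infixr 5 _∷ᴾ_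
_∷ᴾ_ : ∀ {k m f g} → IsPR k f → IsPR* k m g → IsPR* k (suc m) (λ xs → f xs ∷ g xs)
(p , p≗f) ∷ᴾ (ps , ps≗g) = p ∷ ps , λ xs → cong₂ _∷_ (p≗f xs) (ps≗g xs)

infixr 4 _∘ᴾ_
_∘ᴾ_ : ∀ {k m f g} → IsPR m f → IsPR* k m g → IsPR k (λ xs → f (g xs))
_∘ᴾ_ {f = f} (p , p≗f) (ps , ps≗g) = comp p ps , λ xs → trans (p≗f _) (cong f (ps≗g xs))

prec-PR : ∀ {k f g} → IsPR k f → IsPR (suc (suc k)) g → (h : Vec ℕ (suc k) → ℕ) →
          (∀ xs → h (0 ∷ xs) ≡ f xs) → (∀ n xs → h (suc n ∷ xs) ≡ g (n ∷ h (n ∷ xs) ∷ xs)) →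
          IsPR (suc k) h
prec-PR {g = g} (pf , pf≗f) (pg , pg≗g) h h-zero h-suc = prec pf pg , prec≗h
  where
  prec≗h : ∀ xs → eval (prec pf pg) xs ≡ h xs
  prec≗h (zero  ∷ xs) = trans (pf≗f xs) (sym (h-zero xs))
  prec≗h (suc n ∷ xs) = begin
    eval pg (n ∷ eval (prec pf pg) (n ∷ xs) ∷ xs) ≡⟨ pg≗g _ ⟩
    g (n ∷ eval (prec pf pg) (n ∷ xs) ∷ xs)       ≡⟨ cong (λ r → g (n ∷ r ∷ xs)) (prec≗h (n ∷ xs)) ⟩
    g (n ∷ h (n ∷ xs) ∷ xs)                       ≡⟨ sym (h-suc n xs) ⟩
    h (suc n ∷ xs)                                ∎
    where open ≡-Reasoning

suc-PR : PrimRec 1 suc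
suc-PR = succ , λ { (x ∷ []) → refl }

const-PR : ∀ {k} n → IsPR k (λ _ → n)
const-PR zero    = comp zer [] , λ _ → refl
const-PR (suc n) = suc-PR ∘ᴾ const-PR n ∷ᴾ []ᴾ

+-PR : PrimRec 2 _+_
+-PR = prec-PR (π (# 0)) (suc-PR ∘ᴾ π (# 1) ∷ᴾ []ᴾ) _
  (λ { (y ∷ []) → refl }) (λ { n (y ∷ []) → refl })

2*-PR : PrimRec 1 (2 *_)
2*-PR = IsPR-cong (+-PR ∘ᴾ π (# 0) ∷ᴾ π (# 0) ∷ᴾ []ᴾ)
  λ { (x ∷ []) → cong (x +_) (sym (+-identityʳ x)) }

pred-PR : PrimRec 1 pred
pred-PR = prec-PR (const-PR 0) (π (# 0)) _ (λ { [] → refl }) (λ { n [] → refl })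

∸-PR : PrimRec 2 _∸_
∸-PR = IsPR-cong (flipped ∘ᴾ π (# 1) ∷ᴾ π (# 0) ∷ᴾ []ᴾ) λ { (x ∷ y ∷ []) → refl }
  where
  flipped : PrimRec 2 (λ n m → m ∸ n)
  flipped = prec-PR (π (# 0)) (pred-PR ∘ᴾ π (# 1) ∷ᴾ []ᴾ) _
    (λ { (m ∷ []) → refl }) (λ { n (m ∷ []) → sym (pred[m∸n]≡m∸[1+n] m n) })

⌊/2⌋-PR : PrimRec 1 ⌊_/2⌋
⌊/2⌋-PR = prec-PR (const-PR 0) (∸-PR ∘ᴾ π (# 0) ∷ᴾ π (# 1) ∷ᴾ []ᴾ) _
  (λ { [] → refl }) (λ { n [] → ⌊1+n/2⌋≡n∸⌊n/2⌋ n })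
  where
  ⌊1+n/2⌋≡n∸⌊n/2⌋ : ∀ n → ⌊ suc n /2⌋ ≡ n ∸ ⌊ n /2⌋
  ⌊1+n/2⌋≡n∸⌊n/2⌋ n = begin
    ⌊ suc n /2⌋                          ≡⟨ sym (m+n∸m≡n ⌊ n /2⌋ ⌊ suc n /2⌋) ⟩
    ⌊ n /2⌋ + ⌊ suc n /2⌋ ∸ ⌊ n /2⌋      ≡⟨ cong (_∸ ⌊ n /2⌋) (⌊n/2⌋+⌈n/2⌉≡n n) ⟩
    n ∸ ⌊ n /2⌋                          ∎
    where open ≡-Reasoning

%2-PR : PrimRec 1 (_% 2)
%2-PR = prec-PR (const-PR 0) (∸-PR ∘ᴾ const-PR 1 ∷ᴾ π (# 1) ∷ᴾ []ᴾ) _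
  (λ { [] → refl }) (λ { n [] → [1+n]%2≡1∸n%2 n })
  where
  [1+n]%2≡1∸n%2 : ∀ n → suc n % 2 ≡ 1 ∸ n % 2
  [1+n]%2≡1∸n%2 zero          = refl
  [1+n]%2≡1∸n%2 (suc zero)    = refl
  [1+n]%2≡1∸n%2 (suc (suc n)) = [1+n]%2≡1∸n%2 n

2^-PR : PrimRec 1 (2 ^_)
2^-PR = prec-PR (const-PR 1) (2*-PR ∘ᴾ π (# 1) ∷ᴾ []ᴾ) _ (λ { [] → refl }) (λ { n [] → refl })

ifZero : ℕ → ℕ → ℕ → ℕ
ifZero zero    a b = a
ifZero (suc _) a b = b

ifZero-PR : PrimRec 3 ifZero
ifZero-PR = prec-PR (π (# 0)) (π (# 3)) _
  (λ { (a ∷ b ∷ []) → refl }) (λ { n (a ∷ b ∷ []) → refl })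

fold-PR : ∀ {s} → PrimRec 1 s → PrimRec 2 (λ n z → fold z s n)
fold-PR s-PR = prec-PR (π (# 0)) (s-PR ∘ᴾ π (# 1) ∷ᴾ []ᴾ) _
  (λ { (z ∷ []) → refl }) (λ { n (z ∷ []) → refl })

bit-PR : PrimRec 2 bit
bit-PR = IsPR-cong (%2-PR ∘ᴾ (fold-PR ⌊/2⌋-PR ∘ᴾ π (# 1) ∷ᴾ π (# 0) ∷ᴾ []ᴾ) ∷ᴾ []ᴾ)
  λ { (n ∷ i ∷ []) → sym (bit≡fold-⌊/2⌋ n i) }
  where
  bit≡iterate-⌊/2⌋ : ∀ n i → bit n i ≡ iterate ⌊_/2⌋ n i % 2
  bit≡iterate-⌊/2⌋ n zero    = refl
  bit≡iterate-⌊/2⌋ n (suc i) = bit≡iterate-⌊/2⌋ ⌊ n /2⌋ i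
  bit≡fold-⌊/2⌋ : ∀ n i → bit n i ≡ fold n ⌊_/2⌋ i % 2
  bit≡fold-⌊/2⌋ n i = trans (bit≡iterate-⌊/2⌋ n i) (cong (_% 2) (sym (iterate-is-fold n ⌊_/2⌋ i)))

-- The j-th step acts at position next^j p whatever the state, which keeps the loop primitive recursive.
walk : (ℕ → ℕ → ℕ) → (ℕ → ℕ) → ℕ → ℕ → ℕ → ℕ
walk step next zero    p s = s
walk step next (suc k) p s = step (fold p next k) (walk step next k p s)

walk-suc : ∀ step next k p s → walk step next (suc k) p s ≡ walk step next k (next p) (step p s)
walk-suc step next zero    p s = refl
walk-suc step next (suc k) p s = cong₂ step fold-next (walk-suc step next k p s)
  where
  fold-next : fold p next (suc k) ≡ fold (next p) next k
  fold-next = trans (cong (fold p next) (+-comm 1 k)) (fold-+ p next k)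

walk-PR : ∀ {step next} → PrimRec 3 step → PrimRec 1 next →
          PrimRec 4 (λ k a p s → walk (step a) next k p s)
walk-PR step-PR next-PR = prec-PR (π (# 2))
  (step-PR ∘ᴾ π (# 2) ∷ᴾ (fold-PR next-PR ∘ᴾ π (# 0) ∷ᴾ π (# 3) ∷ᴾ []ᴾ) ∷ᴾ π (# 1) ∷ᴾ []ᴾ) _
  (λ { (a ∷ p ∷ s ∷ []) → refl }) (λ { n (a ∷ p ∷ s ∷ []) → refl })

-- Binary digits

⌊m+2n/2⌋≡⌊m/2⌋+n : ∀ m n → ⌊ m + 2 * n /2⌋ ≡ ⌊ m /2⌋ + n
⌊m+2n/2⌋≡⌊m/2⌋+n m n = trans (cong ⌊_/2⌋ (trans (+-comm m (2 * n)) (cong (_+ m) (*-comm 2 n))))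
                                 (⌊n*2+m/2⌋≡⌊m/2⌋+n n)
  where
  ⌊n*2+m/2⌋≡⌊m/2⌋+n : ∀ n → ⌊ n * 2 + m /2⌋ ≡ ⌊ m /2⌋ + n
  ⌊n*2+m/2⌋≡⌊m/2⌋+n zero    = sym (+-identityʳ _)
  ⌊n*2+m/2⌋≡⌊m/2⌋+n (suc n) = trans (cong suc (⌊n*2+m/2⌋≡⌊m/2⌋+n n)) (sym (+-suc _ n))

[m+2n]%2≡m%2 : ∀ m n → (m + 2 * n) % 2 ≡ m % 2
[m+2n]%2≡m%2 m n = trans (cong (λ t → (m + t) % 2) (*-comm 2 n)) ([m+kn]%n≡m%n m n 2)

m%2+2⌊m/2⌋≡m : ∀ m → m % 2 + 2 * ⌊ m /2⌋ ≡ m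
m%2+2⌊m/2⌋≡m m = trans (+-comm (m % 2) _) (trans (cong (_+ m % 2) (*-comm 2 ⌊ m /2⌋)) (⌊m/2⌋*2+m%2≡m m))
  where
  ⌊m/2⌋*2+m%2≡m : ∀ m → ⌊ m /2⌋ * 2 + m % 2 ≡ m
  ⌊m/2⌋*2+m%2≡m zero          = refl
  ⌊m/2⌋*2+m%2≡m (suc zero)    = refl
  ⌊m/2⌋*2+m%2≡m (suc (suc m)) = cong (suc ∘ suc) (⌊m/2⌋*2+m%2≡m m)

m≤1+n⇒⌊m/2⌋≤n : ∀ {m n} → m ≤ suc n → ⌊ m /2⌋ ≤ n
m≤1+n⇒⌊m/2⌋≤n {n = n} m≤1+n = ≤-trans (⌊n/2⌋-mono m≤1+n) (≤-pred (⌊n/2⌋<n n))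

bit-boolean : ∀ n i → bit n i ≡ 0 ⊎ bit n i ≡ 1
bit-boolean zero          zero    = inj₁ refl
bit-boolean (suc zero)    zero    = inj₂ refl
bit-boolean (suc (suc n)) zero    = bit-boolean n zero
bit-boolean n             (suc i) = bit-boolean ⌊ n /2⌋ i

≤⇒bit≡0 : ∀ {n i} → n ≤ i → bit n i ≡ 0
≤⇒bit≡0 {i = zero}  z≤n   = refl
≤⇒bit≡0 {i = suc i} n≤1+i = ≤⇒bit≡0 (m≤1+n⇒⌊m/2⌋≤n n≤1+i)

bit-ext : ∀ {x y} → (∀ i → bit x i ≡ bit y i) → x ≡ y
bit-ext {x} {y} = bit-ext-≤ (x + y) (m≤m+n x y) (m≤n+m y x)
  where
  bit-ext-≤ : ∀ {x y} b → x ≤ b → y ≤ b → (∀ i → bit x i ≡ bit y i) → x ≡ y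
  bit-ext-≤ zero    z≤n z≤n _ = refl
  bit-ext-≤ {x} {y} (suc b) x≤b y≤b same = begin
    x                        ≡⟨ sym (m%2+2⌊m/2⌋≡m x) ⟩
    x % 2 + 2 * ⌊ x /2⌋      ≡⟨ cong₂ (λ r h → r + 2 * h) (same 0)
                                  (bit-ext-≤ b (m≤1+n⇒⌊m/2⌋≤n x≤b) (m≤1+n⇒⌊m/2⌋≤n y≤b) (same ∘ suc)) ⟩
    y % 2 + 2 * ⌊ y /2⌋      ≡⟨ m%2+2⌊m/2⌋≡m y ⟩
    y                        ∎
    where open ≡-Reasoning

even-+1 : ∀ n → n % 2 ≡ 0 → (n + 1) % 2 ≡ 1 × ⌊ n + 1 /2⌋ ≡ ⌊ n /2⌋
even-+1 zero          _    = refl , refl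
even-+1 (suc zero)    ()
even-+1 (suc (suc n)) even = proj₁ (even-+1 n even) , cong suc (proj₂ (even-+1 n even))

bit-+2^-same : ∀ n i → bit n i ≡ 0 → bit (n + 2 ^ i) i ≡ 1
bit-+2^-same n zero    b≡0 = proj₁ (even-+1 n b≡0)
bit-+2^-same n (suc i) b≡0 =
  trans (cong (λ x → bit x i) (⌊m+2n/2⌋≡⌊m/2⌋+n n (2 ^ i))) (bit-+2^-same ⌊ n /2⌋ i b≡0)

bit-+2^-other : ∀ n i j → bit n i ≡ 0 → j ≢ i → bit (n + 2 ^ i) j ≡ bit n j
bit-+2^-other n zero    zero    _   j≢i = contradiction refl j≢i
bit-+2^-other n zero    (suc j) b≡0 _   = cong (λ x → bit x j) (proj₂ (even-+1 n b≡0))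
bit-+2^-other n (suc i) zero    _   _   = [m+2n]%2≡m%2 n (2 ^ i)
bit-+2^-other n (suc i) (suc j) b≡0 j≢i =
  trans (cong (λ x → bit x j) (⌊m+2n/2⌋≡⌊m/2⌋+n n (2 ^ i)))
        (bit-+2^-other ⌊ n /2⌋ i j b≡0 (j≢i ∘ cong suc))

bit-+d*2^-same : ∀ {d} → d ≡ 0 ⊎ d ≡ 1 → ∀ n i → bit n i ≡ 0 → bit (n + d * 2 ^ i) i ≡ d
bit-+d*2^-same (inj₁ refl) n i b≡0 = trans (cong (λ x → bit x i) (+-identityʳ n)) b≡0
bit-+d*2^-same (inj₂ refl) n i b≡0 =
  trans (cong (λ x → bit (n + x) i) (+-identityʳ (2 ^ i))) (bit-+2^-same n i b≡0)

bit-+d*2^-other : ∀ {d} → d ≡ 0 ⊎ d ≡ 1 → ∀ n i j → bit n i ≡ 0 → j ≢ i →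
                  bit (n + d * 2 ^ i) j ≡ bit n j
bit-+d*2^-other (inj₁ refl) n i j _   _   = cong (λ x → bit x j) (+-identityʳ n)
bit-+d*2^-other (inj₂ refl) n i j b≡0 j≢i =
  trans (cong (λ x → bit (n + x) j) (+-identityʳ (2 ^ i))) (bit-+2^-other n i j b≡0 j≢i)

bit≡1⇒split : ∀ n i → bit n i ≡ 1 → ∃ λ m → n ≡ m + 2 ^ i × bit m i ≡ 0
bit≡1⇒split n zero    odd = 2 * ⌊ n /2⌋ , n≡ , [m+2n]%2≡m%2 0 ⌊ n /2⌋
  where
  n≡ : n ≡ 2 * ⌊ n /2⌋ + 1
  n≡ = trans (sym (m%2+2⌊m/2⌋≡m n)) (trans (cong (_+ 2 * ⌊ n /2⌋) odd) (+-comm 1 _))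
bit≡1⇒split n (suc i) b≡1 with bit≡1⇒split ⌊ n /2⌋ i b≡1
... | m , ⌊n/2⌋≡m+2^i , bm≡0 = n % 2 + 2 * m , n≡ , bit≡0
  where
  open ≡-Reasoning
  n≡ : n ≡ n % 2 + 2 * m + 2 ^ suc i
  n≡ = begin
    n                             ≡⟨ sym (m%2+2⌊m/2⌋≡m n) ⟩
    n % 2 + 2 * ⌊ n /2⌋           ≡⟨ cong (λ h → n % 2 + 2 * h) ⌊n/2⌋≡m+2^i ⟩
    n % 2 + 2 * (m + 2 ^ i)       ≡⟨ cong (n % 2 +_) (*-distribˡ-+ 2 m (2 ^ i)) ⟩
    n % 2 + (2 * m + 2 * 2 ^ i)   ≡⟨ sym (+-assoc (n % 2) _ _) ⟩
    n % 2 + 2 * m + 2 ^ suc i     ∎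
  ⌊n%2/2⌋≡0 : ∀ n → ⌊ n % 2 /2⌋ ≡ 0
  ⌊n%2/2⌋≡0 zero          = refl
  ⌊n%2/2⌋≡0 (suc zero)    = refl
  ⌊n%2/2⌋≡0 (suc (suc n)) = ⌊n%2/2⌋≡0 n
  bit≡0 : bit (n % 2 + 2 * m) (suc i) ≡ 0
  bit≡0 = begin
    bit ⌊ n % 2 + 2 * m /2⌋ i     ≡⟨ cong (λ x → bit x i) (⌊m+2n/2⌋≡⌊m/2⌋+n (n % 2) m) ⟩
    bit (⌊ n % 2 /2⌋ + m) i       ≡⟨ cong (λ h → bit (h + m) i) (⌊n%2/2⌋≡0 n) ⟩
    bit m i                       ≡⟨ bm≡0 ⟩
    0                             ∎

-- Permuting binary digits

ctildeBelow : (ℕ → ℕ) → ℕ → ℕ → ℕ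
ctildeBelow f K x = sumBelow K (λ i → bit x i * 2 ^ f i)

module _ {f : ℕ → ℕ} (f-inj : Injective _≡_ _≡_ f) (x : ℕ) where

  bit-ctildeBelow-≥ : ∀ K {j} → K ≤ j → bit (ctildeBelow f K x) (f j) ≡ 0
  bit-ctildeBelow-≥ zero    {j} _ = ≤⇒bit≡0 {i = f j} z≤n
  bit-ctildeBelow-≥ (suc K) {j} K<j =
    trans (bit-+d*2^-other (bit-boolean x K) _ (f K) (f j) (bit-ctildeBelow-≥ K ≤-refl) (>⇒≢ K<j ∘ f-inj))
          (bit-ctildeBelow-≥ K (<⇒≤ K<j))

  bit-ctildeBelow-< : ∀ K {j} → j < K → bit (ctildeBelow f K x) (f j) ≡ bit x j
  bit-ctildeBelow-< (suc K) {j} j<1+K with j ≟ K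
  ... | yes refl = bit-+d*2^-same (bit-boolean x K) _ (f K) (bit-ctildeBelow-≥ K ≤-refl)
  ... | no  j≢K  =
    trans (bit-+d*2^-other (bit-boolean x K) _ (f K) (f j) (bit-ctildeBelow-≥ K ≤-refl) (j≢K ∘ f-inj))
          (bit-ctildeBelow-< K (≤∧≢⇒< (≤-pred j<1+K) j≢K))

  bit-ctilde : ∀ j → bit (ctilde f x) (f j) ≡ bit x j
  bit-ctilde j with x ≤? j
  ... | yes x≤j = trans (bit-ctildeBelow-≥ x x≤j) (sym (≤⇒bit≡0 x≤j))
  ... | no  x≰j = bit-ctildeBelow-< x (≰⇒> x≰j)

module DigitPermutation {c : ℕ → ℕ} (c-bij : Bijective _≡_ _≡_ c) where

  c-inj : Injective _≡_ _≡_ c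
  c-inj = proj₁ c-bij

  c⁻¹ : ℕ → ℕ
  c⁻¹ p = proj₁ (proj₂ c-bij p)

  c∘c⁻¹ : ∀ p → c (c⁻¹ p) ≡ p
  c∘c⁻¹ p = proj₂ (proj₂ c-bij p) refl

  c⁻¹-inj : Injective _≡_ _≡_ c⁻¹
  c⁻¹-inj {p} {q} eq = trans (sym (c∘c⁻¹ p)) (trans (cong c eq) (c∘c⁻¹ q))

  bit∘c-ext : ∀ {x y} → (∀ j → bit x (c j) ≡ bit y (c j)) → x ≡ y
  bit∘c-ext {x} {y} same = bit-ext λ p → subst (λ q → bit x q ≡ bit y q) (c∘c⁻¹ p) (same (c⁻¹ p))

  ctilde-+2^ : ∀ n i → bit n i ≡ 0 → ctilde c (n + 2 ^ i) ≡ ctilde c n + 2 ^ c i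
  ctilde-+2^ n i b≡0 = bit∘c-ext same
    where
    b̃≡0 : bit (ctilde c n) (c i) ≡ 0
    b̃≡0 = trans (bit-ctilde c-inj n i) b≡0
    same : ∀ j → bit (ctilde c (n + 2 ^ i)) (c j) ≡ bit (ctilde c n + 2 ^ c i) (c j)
    same j with j ≟ i
    ... | yes refl = begin
      bit (ctilde c (n + 2 ^ i)) (c i)   ≡⟨ bit-ctilde c-inj (n + 2 ^ i) i ⟩
      bit (n + 2 ^ i) i                  ≡⟨ bit-+2^-same n i b≡0 ⟩
      1                                  ≡⟨ sym (bit-+2^-same _ (c i) b̃≡0) ⟩
      bit (ctilde c n + 2 ^ c i) (c i)   ∎
      where open ≡-Reasoning
    ... | no j≢i = begin
      bit (ctilde c (n + 2 ^ i)) (c j)   ≡⟨ bit-ctilde c-inj (n + 2 ^ i) j ⟩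
      bit (n + 2 ^ i) j                  ≡⟨ bit-+2^-other n i j b≡0 j≢i ⟩
      bit n j                            ≡⟨ sym (bit-ctilde c-inj n j) ⟩
      bit (ctilde c n) (c j)             ≡⟨ sym (bit-+2^-other _ (c i) (c j) b̃≡0 (j≢i ∘ c-inj)) ⟩
      bit (ctilde c n + 2 ^ c i) (c j)   ∎
      where open ≡-Reasoning

  ctilde⁻¹∘ctilde : ∀ m → ctilde c⁻¹ (ctilde c m) ≡ m
  ctilde⁻¹∘ctilde m = bit-ext λ i → begin
    bit (ctilde c⁻¹ (ctilde c m)) i           ≡⟨ cong (bit _) (sym (c-inj (c∘c⁻¹ (c i)))) ⟩
    bit (ctilde c⁻¹ (ctilde c m)) (c⁻¹ (c i)) ≡⟨ bit-ctilde c⁻¹-inj (ctilde c m) (c i) ⟩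
    bit (ctilde c m) (c i)                    ≡⟨ bit-ctilde c-inj m i ⟩
    bit m i                                   ∎
    where open ≡-Reasoning

-- Arithmetic of the copy Ã

-- The carry loop keeps 2x + 1 once the carry has been absorbed into x, and 2x while it is pending.
pending settled : ℕ → ℕ
pending x = 2 * x
settled x = 1 + 2 * x

carry : ℕ → ℕ → ℕ
carry q x = ifZero (bit x q) (settled (x + 2 ^ q)) (pending (x ∸ 2 ^ q))

carry-bit≡0 : ∀ q x → bit x q ≡ 0 → carry q x ≡ settled (x + 2 ^ q)
carry-bit≡0 q x = cong (λ b → ifZero b (settled (x + 2 ^ q)) (pending (x ∸ 2 ^ q)))

carry-bit≡1 : ∀ q x → bit x q ≡ 1 → carry q x ≡ pending (x ∸ 2 ^ q)
carry-bit≡1 q x = cong (λ b → ifZero b (settled (x + 2 ^ q)) (pending (x ∸ 2 ^ q)))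

carryStep : ℕ → ℕ → ℕ
carryStep q s = ifZero (s % 2) (carry q ⌊ s /2⌋) s

carryStep-pending : ∀ q x → carryStep q (pending x) ≡ carry q x
carryStep-pending q x =
  cong₂ (λ b y → ifZero b (carry q y) (pending x)) ([m+2n]%2≡m%2 0 x) (⌊m+2n/2⌋≡⌊m/2⌋+n 0 x)

carryStep-settled : ∀ q x → carryStep q (settled x) ≡ settled x
carryStep-settled q x = cong (λ b → ifZero b (carry q ⌊ settled x /2⌋) (settled x)) ([m+2n]%2≡m%2 1 x)

walk-carryStep-settled : ∀ next k q x → walk carryStep next k q (settled x) ≡ settled x
walk-carryStep-settled next zero    q x = refl
walk-carryStep-settled next (suc k) q x =
  trans (cong (carryStep (fold q next k)) (walk-carryStep-settled next k q x)) (carryStep-settled (fold q next k) x)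

settled-PR : PrimRec 1 settled
settled-PR = IsPR-cong (suc-PR ∘ᴾ (2*-PR ∘ᴾ π (# 0) ∷ᴾ []ᴾ) ∷ᴾ []ᴾ) λ { (x ∷ []) → refl }

carry-PR : PrimRec 2 carry
carry-PR = IsPR-cong
  (ifZero-PR ∘ᴾ (bit-PR ∘ᴾ π (# 1) ∷ᴾ π (# 0) ∷ᴾ []ᴾ)
             ∷ᴾ (settled-PR ∘ᴾ (+-PR ∘ᴾ π (# 1) ∷ᴾ (2^-PR ∘ᴾ π (# 0) ∷ᴾ []ᴾ) ∷ᴾ []ᴾ) ∷ᴾ []ᴾ)
             ∷ᴾ (2*-PR ∘ᴾ (∸-PR ∘ᴾ π (# 1) ∷ᴾ (2^-PR ∘ᴾ π (# 0) ∷ᴾ []ᴾ) ∷ᴾ []ᴾ) ∷ᴾ []ᴾ)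
             ∷ᴾ []ᴾ)
  λ { (q ∷ x ∷ []) → refl }

carryStep-PR : PrimRec 2 carryStep
carryStep-PR = IsPR-cong
  (ifZero-PR ∘ᴾ (%2-PR ∘ᴾ π (# 1) ∷ᴾ []ᴾ)
             ∷ᴾ (carry-PR ∘ᴾ π (# 0) ∷ᴾ (⌊/2⌋-PR ∘ᴾ π (# 1) ∷ᴾ []ᴾ) ∷ᴾ []ᴾ)
             ∷ᴾ π (# 1)
             ∷ᴾ []ᴾ)
  λ { (q ∷ s ∷ []) → refl }

module TildeCopy (A : PunctualCopy) where
  open PunctualCopy A
  open DigitPermutation c-bij
  open ≡-Reasoning

  c̃ : ℕ → ℕ
  c̃ = ctilde c

  carry-c̃-bit≡0 : ∀ n i → bit n i ≡ 0 → carry (c i) (c̃ n) ≡ settled (c̃ (n + 2 ^ i))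
  carry-c̃-bit≡0 n i b≡0 = begin
    carry (c i) (c̃ n)             ≡⟨ carry-bit≡0 (c i) (c̃ n) (trans (bit-ctilde c-inj n i) b≡0) ⟩
    settled (c̃ n + 2 ^ c i)       ≡⟨ cong settled (sym (ctilde-+2^ n i b≡0)) ⟩
    settled (c̃ (n + 2 ^ i))       ∎

  carry-c̃-bit≡1 : ∀ m i → bit m i ≡ 0 → carry (c i) (c̃ (m + 2 ^ i)) ≡ pending (c̃ m)
  carry-c̃-bit≡1 m i b≡0 = begin
    carry (c i) (c̃ (m + 2 ^ i))         ≡⟨ cong (carry (c i)) (ctilde-+2^ m i b≡0) ⟩
    carry (c i) (c̃ m + 2 ^ c i)
      ≡⟨ carry-bit≡1 (c i) (c̃ m + 2 ^ c i) (bit-+2^-same (c̃ m) (c i) (trans (bit-ctilde c-inj m i) b≡0)) ⟩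
    pending (c̃ m + 2 ^ c i ∸ 2 ^ c i)   ≡⟨ cong pending (m+n∸n≡m (c̃ m) (2 ^ c i)) ⟩
    pending (c̃ m)                       ∎

  carryLoop : ℕ → ℕ → ℕ → ℕ
  carryLoop = walk carryStep SA

  carryLoop-c̃ : ∀ k n i → c̃ n < k → carryLoop k (c i) (pending (c̃ n)) ≡ settled (c̃ (n + 2 ^ i))
  carryLoop-c̃ (suc k) n i (s≤s c̃n≤k) with bit-boolean n i
  ... | inj₁ b≡0 = begin
    carryLoop (suc k) (c i) (pending (c̃ n))                 ≡⟨ walk-suc carryStep SA k (c i) _ ⟩
    carryLoop k (SA (c i)) (carryStep (c i) (pending (c̃ n)))
      ≡⟨ cong (carryLoop k (SA (c i))) (trans (carryStep-pending (c i) (c̃ n)) (carry-c̃-bit≡0 n i b≡0)) ⟩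
    carryLoop k (SA (c i)) (settled (c̃ (n + 2 ^ i)))
      ≡⟨ walk-carryStep-settled SA k (SA (c i)) (c̃ (n + 2 ^ i)) ⟩
    settled (c̃ (n + 2 ^ i))                                 ∎
  ... | inj₂ b≡1 with bit≡1⇒split n i b≡1
  ...   | m , refl , bm≡0 = begin
    carryLoop (suc k) (c i) (pending (c̃ (m + 2 ^ i)))       ≡⟨ walk-suc carryStep SA k (c i) _ ⟩
    carryLoop k (SA (c i)) (carryStep (c i) (pending (c̃ (m + 2 ^ i))))
      ≡⟨ cong₂ (carryLoop k) (sym (c-hom i))
               (trans (carryStep-pending (c i) (c̃ (m + 2 ^ i))) (carry-c̃-bit≡1 m i bm≡0)) ⟩
    carryLoop k (c (suc i)) (pending (c̃ m))                  ≡⟨ carryLoop-c̃ k m (suc i) c̃m<k ⟩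
    settled (c̃ (m + 2 ^ suc i))                              ≡⟨ cong (settled ∘ c̃) m+2^[1+i]≡m+2^i+2^i ⟩
    settled (c̃ (m + 2 ^ i + 2 ^ i))                          ∎
    where
    c̃m<k : c̃ m < k
    c̃m<k = <-≤-trans (subst (c̃ m <_) (sym (ctilde-+2^ m i bm≡0)) (m<m+n _ (m^n>0 2 (c i)))) c̃n≤k
    m+2^[1+i]≡m+2^i+2^i : m + 2 ^ suc i ≡ m + 2 ^ i + 2 ^ i
    m+2^[1+i]≡m+2^i+2^i = trans (cong (λ t → m + (2 ^ i + t)) (+-identityʳ (2 ^ i))) (sym (+-assoc m _ _))

  increment : ℕ → ℕ → ℕ
  increment x q = ⌊ carryLoop (suc x) q (pending x) /2⌋

  increment-c̃ : ∀ n i → increment (c̃ n) (c i) ≡ c̃ (n + 2 ^ i)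
  increment-c̃ n i = trans (cong ⌊_/2⌋ (carryLoop-c̃ (suc (c̃ n)) n i ≤-refl)) (⌊m+2n/2⌋≡⌊m/2⌋+n 1 _)

  SÃ : ℕ → ℕ
  SÃ x = increment x (c 0)

  SÃ-c̃ : ∀ n → SÃ (c̃ n) ≡ c̃ (suc n)
  SÃ-c̃ n = trans (increment-c̃ n 0) (cong c̃ (+-comm n 1))

  addStep : ℕ → ℕ → ℕ → ℕ
  addStep y p s = ifZero (bit y p) s (increment s p)

  addStep-c̃ : ∀ y p n → addStep y p (c̃ n) ≡ c̃ (n + bit y p * 2 ^ c⁻¹ p)
  addStep-c̃ y p n with bit-boolean y p
  ... | inj₁ b≡0 = begin
    addStep y p (c̃ n)                ≡⟨ cong (λ b → ifZero b (c̃ n) (increment (c̃ n) p)) b≡0 ⟩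
    c̃ n                              ≡⟨ cong c̃ (sym (+-identityʳ n)) ⟩
    c̃ (n + 0 * 2 ^ c⁻¹ p)            ≡⟨ cong (λ b → c̃ (n + b * 2 ^ c⁻¹ p)) (sym b≡0) ⟩
    c̃ (n + bit y p * 2 ^ c⁻¹ p)      ∎
  ... | inj₂ b≡1 = begin
    addStep y p (c̃ n)                ≡⟨ cong (λ b → ifZero b (c̃ n) (increment (c̃ n) p)) b≡1 ⟩
    increment (c̃ n) p                ≡⟨ cong (increment (c̃ n)) (sym (c∘c⁻¹ p)) ⟩
    increment (c̃ n) (c (c⁻¹ p))      ≡⟨ increment-c̃ n (c⁻¹ p) ⟩
    c̃ (n + 2 ^ c⁻¹ p)                ≡⟨ cong (λ t → c̃ (n + t)) (sym (*-identityˡ _)) ⟩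
    c̃ (n + 1 * 2 ^ c⁻¹ p)            ≡⟨ cong (λ b → c̃ (n + b * 2 ^ c⁻¹ p)) (sym b≡1) ⟩
    c̃ (n + bit y p * 2 ^ c⁻¹ p)      ∎

  infixl 6 _+Ã_
  _+Ã_ : ℕ → ℕ → ℕ
  x +Ã y = walk (addStep y) suc y 0 x

  walk-addStep : ∀ y K n → walk (addStep y) suc K 0 (c̃ n) ≡ c̃ (n + ctildeBelow c⁻¹ K y)
  walk-addStep y zero    n = cong c̃ (sym (+-identityʳ n))
  walk-addStep y (suc K) n = begin
    addStep y (fold 0 suc K) (walk (addStep y) suc K 0 (c̃ n))
      ≡⟨ cong₂ (addStep y) (id-is-fold K) (walk-addStep y K n) ⟩
    addStep y K (c̃ (n + ctildeBelow c⁻¹ K y))             ≡⟨ addStep-c̃ y K (n + ctildeBelow c⁻¹ K y) ⟩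
    c̃ (n + ctildeBelow c⁻¹ K y + bit y K * 2 ^ c⁻¹ K)     ≡⟨ cong c̃ (+-assoc n _ _) ⟩
    c̃ (n + ctildeBelow c⁻¹ (suc K) y)                     ∎

  +Ã-c̃ : ∀ n m → c̃ n +Ã c̃ m ≡ c̃ (n + m)
  +Ã-c̃ n m = trans (walk-addStep (c̃ m) (c̃ m) n) (cong (λ t → c̃ (n + t)) (ctilde⁻¹∘ctilde m))

  increment-PR : PrimRec 2 increment
  increment-PR = IsPR-cong
    (⌊/2⌋-PR ∘ᴾ (walk-PR carryStep′-PR (PrimRec₁⇒PrimRec SA-pr)
                   ∘ᴾ (suc-PR ∘ᴾ π (# 0) ∷ᴾ []ᴾ) ∷ᴾ const-PR 0 ∷ᴾ π (# 1) ∷ᴾ (2*-PR ∘ᴾ π (# 0) ∷ᴾ []ᴾ) ∷ᴾ []ᴾ)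
             ∷ᴾ []ᴾ)
    λ { (x ∷ q ∷ []) → refl }
    where
    carryStep′-PR : PrimRec 3 (λ _ → carryStep)
    carryStep′-PR = IsPR-cong (carryStep-PR ∘ᴾ π (# 1) ∷ᴾ π (# 2) ∷ᴾ []ᴾ) λ { (a ∷ q ∷ s ∷ []) → refl }

  SÃ-PR : PrimRec 1 SÃ
  SÃ-PR = IsPR-cong (increment-PR ∘ᴾ π (# 0) ∷ᴾ const-PR (c 0) ∷ᴾ []ᴾ) λ { (x ∷ []) → refl }

  addStep-PR : PrimRec 3 addStep
  addStep-PR = IsPR-cong
    (ifZero-PR ∘ᴾ (bit-PR ∘ᴾ π (# 0) ∷ᴾ π (# 1) ∷ᴾ []ᴾ)
               ∷ᴾ π (# 2)
               ∷ᴾ (increment-PR ∘ᴾ π (# 2) ∷ᴾ π (# 1) ∷ᴾ []ᴾ)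
               ∷ᴾ []ᴾ)
    λ { (y ∷ p ∷ s ∷ []) → refl }

  +Ã-PR : PrimRec 2 _+Ã_
  +Ã-PR = IsPR-cong (walk-PR addStep-PR suc-PR ∘ᴾ π (# 1) ∷ᴾ π (# 1) ∷ᴾ const-PR 0 ∷ᴾ π (# 0) ∷ᴾ []ᴾ)
    λ { (x ∷ y ∷ []) → refl }

mainTheorem10 : (A : PunctualCopy) →
    let c = PunctualCopy.c A in
    Σ (ℕ → ℕ) (λ SÃ → PrimRec₁ SÃ × (∀ n → SÃ (ctilde c n) ≡ ctilde c (suc n)))
    × Σ (ℕ → ℕ → ℕ) (λ addÃ → PrimRec₂ addÃ
        × (∀ n m → addÃ (ctilde c n) (ctilde c m) ≡ ctilde c (n + m)))
mainTheorem10 A =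
  (SÃ , PrimRec⇒PrimRec₁ SÃ-PR , SÃ-c̃) , (_+Ã_ , PrimRec⇒PrimRec₂ +Ã-PR , +Ã-c̃)
  where open TildeCopy A
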